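{- Let $(d,Q,E)$ be a VASS and let $p,p'\in Q$. Let $\tau,\rho$ be two pseudo-runs from $p$ to $p'$ such that $\mathrm{fold}(\tau)-\mathrm{fold}(\rho)\geq \vec 1_E$, i.e. every arc is used by $\tau$ strictly more times than by $\rho$. Then for every non-isolated control state $p''\in Q$ there is a pseudo-run $\sigma$ from $p''$ to $p''$ with $\mathrm{fold}(\sigma)=\mathrm{fold}(\tau)-\mathrm{fold}(\rho)$.
   Context: A vector addition system with states (VASS) of dimension $d\geq 1$ is a finite set $Q$ of control states together with a finite set $E\subseteq Q\times\mathbb{Z}^d\times Q$ of arcs. A pseudo-configuration is a pair $(q,v)\in Q\times\mathbb{Z}^d$. An arc $e=(q,z,q')$ induces a step from $(q,v)$ to $(q',v+z)$ for every $v\in\mathbb{Z}^d$. A pseudo-run is a finite sequence of consecutive steps (equivalently, the inducing sequence of arcs); a pseudo-run from $p$ to $p'$ is one starting in a pseudo-configuration with state $p$ and ending in one with state $p'$ (the vectors being irrelevant). The folding $\mathrm{fold}(\pi)\in\mathbb{N}^E$ of a pseudo-run $\pi$ records for each arc how many times $\pi$ uses it. $\vec 1_E$ is the vector in $\mathbb{Z}^E$ with all entries $1$. A control state is non-isolated if it is the source or target of some arc in the underlying multigraph (vertices $Q$, edges the arcs in $E$). -}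

module Defs where

open import Data.Nat using (ℕ; zero; suc)
open import Data.Integer using (ℤ)
open import Data.Fin using (Fin; _≟_)
open import Data.Vec using (Vec)
open import Data.Product using (_×_; Σ; _,_)
open import Data.Sum using (_⊎_)
open import Relation.Binary.PropositionalEquality using (_≡_)
open import Relation.Nullary using (yes; no)
open import Function.Definitions using (Injective)

-- A VASS of dimension d: control states Fin n, arcs indexed by Fin m.
-- Arc i is the triple (src i, label i, tgt i).  Since E is a *set* of
-- triples, the indexing is required to be injective.
record VASS (d : ℕ) : Set where
  field
    nStates : ℕ
    nArcs   : ℕ
    src     : Fin nArcs → Fin nStates
    label   : Fin nArcs → Vec ℤ d
    tgt     : Fin nArcs → Fin nStates
    arcs-distinct : Injective _≡_ _≡_ (λ i → (src i , label i , tgt i))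

module _ {d : ℕ} (V : VASS d) where
  open VASS V

  State : Set
  State = Fin nStates

  Arc : Set
  Arc = Fin nArcs

  -- Pseudo-runs from q to q' (sequences of consecutive arcs; the vectors
  -- are irrelevant since pseudo-configurations range over all of ℤ^d).
  data PseudoRun : State → State → Set where
    []  : ∀ {q} → PseudoRun q q
    _∷_ : ∀ (e : Arc) {q'} → PseudoRun (tgt e) q' → PseudoRun (src e) q'

  fold : ∀ {q q'} → PseudoRun q q' → Arc → ℕ
  fold [] e = 0
  fold (e' ∷ π) e with e' ≟ e
  ... | yes _ = suc (fold π e)
  ... | no  _ = fold π e

  NonIsolated : State → Set
  NonIsolated q = Σ Arc (λ e → src e ≡ q ⊎ tgt e ≡ q)

module Submission where

-- Proof idea.  Write F π for the folding of a pseudo-run π and call two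
-- pseudo-runs fold-equivalent (π ≋ π') when they use every arc equally
-- often.
--
--  * Splitting: a run using arc e factors as α ++ (e ∷ β), where α avoids e.
--  * Peeling: a run starting at src e that uses e at least twice is
--    fold-equivalent to e ∷ τ' for some run τ' starting at tgt e
--    (reorder α e γ e β into e (γ α e β)).
--  * Difference loop: by induction on ρ, peeling the first arc of ρ off τ
--    each time, two runs ρ, τ from q to r with F ρ < F τ pointwise leave a
--    loop σ at r with F σ + F ρ = F τ.
--  * Rotation: a loop α ++ β is fold-equivalent to the loop β ++ α, so a
--    loop using arc a can be moved to start at src a or at tgt a.
--
-- The loop σ produced for τ and ρ uses every arc (since F ρ < F τ), hence it
-- can be rotated to any non-isolated state p'', which proves lemma1.

open import Defs
open import Data.Nat using (ℕ; zero; suc; _+_; _<_; _≤_; s≤s; s≤s⁻¹; z≤n)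
open import Data.Nat.Properties using (+-assoc; +-comm; +-identityʳ; +-cancelˡ-<; <-irrefl; ≤-trans)
open import Data.Product using (Σ; _×_; _,_)
open import Data.Sum using (_⊎_; inj₁; inj₂)
open import Data.Fin using (_≟_)
open import Data.Empty using (⊥-elim)
open import Relation.Nullary using (yes; no; ¬_)
open import Relation.Binary.PropositionalEquality
open ≡-Reasoning

positive-difference : ∀ m n o → m + n ≡ o → n < o → 1 ≤ m
positive-difference zero    n o m+n≡o n<o = ⊥-elim (<-irrefl m+n≡o n<o)
positive-difference (suc m) n o _     _   = s≤s z≤n

+-swap : ∀ x y z → x + (y + z) ≡ y + (x + z)
+-swap x y z = begin
  x + (y + z)  ≡⟨ sym (+-assoc x y z) ⟩
  (x + y) + z  ≡⟨ cong (_+ z) (+-comm x y) ⟩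
  (y + x) + z  ≡⟨ +-assoc y x z ⟩
  y + (x + z)  ∎

module Runs {d : ℕ} (V : VASS d) where
  open VASS V

  F : ∀ {q q'} → PseudoRun V q q' → Arc V → ℕ
  F = fold V

  _≋_ : ∀ {q₁ q₁' q₂ q₂'} → PseudoRun V q₁ q₁' → PseudoRun V q₂ q₂' → Set
  π ≋ π' = ∀ x → F π x ≡ F π' x

  _++_ : ∀ {q r s} → PseudoRun V q r → PseudoRun V r s → PseudoRun V q s
  []      ++ β = β
  (e ∷ α) ++ β = e ∷ (α ++ β)

  ++-assoc : ∀ {q r s t} (α : PseudoRun V q r) (β : PseudoRun V r s) (γ : PseudoRun V s t) →
             (α ++ β) ++ γ ≡ α ++ (β ++ γ)
  ++-assoc []      β γ = refl
  ++-assoc (e ∷ α) β γ = cong (e ∷_) (++-assoc α β γ)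

  once : (e : Arc V) → PseudoRun V (src e) (tgt e)
  once e = e ∷ []

  fold-∷ : ∀ {r} e (π : PseudoRun V (tgt e) r) x → F (e ∷ π) x ≡ F (once e) x + F π x
  fold-∷ e π x with e ≟ x
  ... | yes _ = refl
  ... | no  _ = refl

  fold-∷-self : ∀ {r} e (π : PseudoRun V (tgt e) r) → F (e ∷ π) e ≡ suc (F π e)
  fold-∷-self e π with e ≟ e
  ... | yes _ = refl
  ... | no e≢e = ⊥-elim (e≢e refl)

  fold-∷-other : ∀ {r} e x (π : PseudoRun V (tgt e) r) → ¬ e ≡ x → F (e ∷ π) x ≡ F π x
  fold-∷-other e x π e≢x with e ≟ x
  ... | yes e≡x = ⊥-elim (e≢x e≡x)
  ... | no  _   = refl

  fold-++ : ∀ {q r s} (α : PseudoRun V q r) (β : PseudoRun V r s) x → F (α ++ β) x ≡ F α x + F β x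
  fold-++ []      β x = refl
  fold-++ (e ∷ α) β x = begin
    F (e ∷ (α ++ β)) x              ≡⟨ fold-∷ e (α ++ β) x ⟩
    F (once e) x + F (α ++ β) x     ≡⟨ cong (F (once e) x +_) (fold-++ α β x) ⟩
    F (once e) x + (F α x + F β x)  ≡⟨ sym (+-assoc (F (once e) x) (F α x) (F β x)) ⟩
    (F (once e) x + F α x) + F β x  ≡⟨ cong (_+ F β x) (sym (fold-∷ e α x)) ⟩
    F (e ∷ α) x + F β x             ∎

  rotate : ∀ {q s} (α : PseudoRun V q s) (β : PseudoRun V s q) → (β ++ α) ≋ (α ++ β)
  rotate α β x = begin
    F (β ++ α) x     ≡⟨ fold-++ β α x ⟩
    F β x + F α x    ≡⟨ +-comm (F β x) (F α x) ⟩
    F α x + F β x    ≡⟨ sym (fold-++ α β x) ⟩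
    F (α ++ β) x     ∎

  split : ∀ {q r} (τ : PseudoRun V q r) e → 1 ≤ F τ e →
          Σ (PseudoRun V q (src e)) λ α → Σ (PseudoRun V (tgt e) r) λ β →
            F α e ≡ 0 × τ ≡ α ++ (e ∷ β)
  split (e' ∷ τ) e uses-e with e' ≟ e
  ... | yes refl = [] , τ , refl , refl
  ... | no e'≢e with split τ e uses-e
  ...   | α , β , α-avoids-e , τ≡ =
            e' ∷ α , β , trans (fold-∷-other e' e α e'≢e) α-avoids-e , cong (e' ∷_) τ≡

  -- A run from src e using e twice is fold-equivalent to e followed by a
  -- run from tgt e: reorder α e γ e β into e γ α e β.
  peel : ∀ {r} e (τ : PseudoRun V (src e) r) → 2 ≤ F τ e →
         Σ (PseudoRun V (tgt e) r) λ τ' → τ ≋ (e ∷ τ')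
  peel e τ twice with split τ e (≤-trans (s≤s z≤n) twice)
  ... | α , β₁ , α-avoids-e , refl with split β₁ e (s≤s⁻¹ (subst (2 ≤_) count twice))
    where
    count : F (α ++ (e ∷ β₁)) e ≡ suc (F β₁ e)
    count = begin
      F (α ++ (e ∷ β₁)) e      ≡⟨ fold-++ α (e ∷ β₁) e ⟩
      F α e + F (e ∷ β₁) e     ≡⟨ cong₂ _+_ α-avoids-e (fold-∷-self e β₁) ⟩
      suc (F β₁ e)             ∎
  ... | γ , β , _ , refl = γ ++ (α ++ (e ∷ β)) , reorder
    where
    reorder : (α ++ (e ∷ (γ ++ (e ∷ β)))) ≋ (e ∷ (γ ++ (α ++ (e ∷ β))))
    reorder x = begin
      F (α ++ (e ∷ (γ ++ (e ∷ β)))) x       ≡⟨ fold-++ α _ x ⟩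
      a + F (e ∷ (γ ++ (e ∷ β))) x          ≡⟨ cong (a +_) (fold-∷ e _ x) ⟩
      a + (o + F (γ ++ (e ∷ β)) x)          ≡⟨ +-swap a o _ ⟩
      o + (a + F (γ ++ (e ∷ β)) x)          ≡⟨ cong (λ t → o + (a + t)) (fold-++ γ (e ∷ β) x) ⟩
      o + (a + (F γ x + F (e ∷ β) x))       ≡⟨ cong (o +_) (+-swap a (F γ x) _) ⟩
      o + (F γ x + (a + F (e ∷ β) x))       ≡⟨ cong (λ t → o + (F γ x + t)) (sym (fold-++ α (e ∷ β) x)) ⟩
      o + (F γ x + F (α ++ (e ∷ β)) x)      ≡⟨ cong (o +_) (sym (fold-++ γ _ x)) ⟩
      o + F (γ ++ (α ++ (e ∷ β))) x         ≡⟨ sym (fold-∷ e _ x) ⟩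
      F (e ∷ (γ ++ (α ++ (e ∷ β)))) x       ∎
      where
      a = F α x
      o = F (once e) x

  difference-loop : ∀ {q r} (ρ τ : PseudoRun V q r) → (∀ x → F ρ x < F τ x) →
                    Σ (PseudoRun V r r) λ σ → ∀ x → F σ x + F ρ x ≡ F τ x
  difference-loop []      τ _   = τ , λ x → +-identityʳ (F τ x)
  difference-loop (e ∷ ρ) τ ρ<τ with peel e τ (≤-trans (s≤s (s≤s z≤n)) (subst (λ n → suc n ≤ F τ e) (fold-∷-self e ρ) (ρ<τ e)))
  ... | τ' , τ≋eτ' with difference-loop ρ τ' ρ<τ'
    where
    ρ<τ' : ∀ x → F ρ x < F τ' x
    ρ<τ' x = +-cancelˡ-< (F (once e) x) (F ρ x) (F τ' x)
               (subst₂ _<_ (fold-∷ e ρ x) (trans (τ≋eτ' x) (fold-∷ e τ' x)) (ρ<τ x))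
  ... | σ , σ+ρ≡τ' = σ , λ x → begin
    F σ x + F (e ∷ ρ) x             ≡⟨ cong (F σ x +_) (fold-∷ e ρ x) ⟩
    F σ x + (F (once e) x + F ρ x)  ≡⟨ +-swap (F σ x) (F (once e) x) (F ρ x) ⟩
    F (once e) x + (F σ x + F ρ x)  ≡⟨ cong (F (once e) x +_) (σ+ρ≡τ' x) ⟩
    F (once e) x + F τ' x           ≡⟨ sym (fold-∷ e τ' x) ⟩
    F (e ∷ τ') x                    ≡⟨ sym (τ≋eτ' x) ⟩
    F τ x                           ∎

  rotate-to-endpoint : ∀ {q} (σ : PseudoRun V q q) a → 1 ≤ F σ a →
                       ∀ {s} → src a ≡ s ⊎ tgt a ≡ s → Σ (PseudoRun V s s) λ σ' → σ' ≋ σ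
  rotate-to-endpoint σ a uses-a endpoint with split σ a uses-a
  rotate-to-endpoint σ a _ (inj₁ refl) | α , β , _ , refl = (a ∷ β) ++ α , rotate α (a ∷ β)
  rotate-to-endpoint σ a _ (inj₂ refl) | α , β , _ , refl =
    β ++ (α ++ once a) , λ x → trans (rotate (α ++ once a) β x) (cong (λ π → F π x) (++-assoc α (once a) β))

lemma1 : {d : ℕ} (V : VASS d) (p p' : State V)
         (τ ρ : PseudoRun V p p') →
         (∀ e → fold V ρ e < fold V τ e) →
         (p'' : State V) → NonIsolated V p'' →
         Σ (PseudoRun V p'' p'') (λ σ → ∀ e → fold V σ e + fold V ρ e ≡ fold V τ e)
lemma1 V p p' τ ρ ρ<τ p'' (a , a-touches-p'') =
  let σ , σ+ρ≡τ = difference-loop ρ τ ρ<τ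
      σ-uses-a = positive-difference (fold V σ a) (fold V ρ a) (fold V τ a) (σ+ρ≡τ a) (ρ<τ a)
      σ' , σ'≋σ = rotate-to-endpoint σ a σ-uses-a a-touches-p''
  in σ' , λ e → trans (cong (_+ fold V ρ e) (σ'≋σ e)) (σ+ρ≡τ e)
  where open Runs V
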